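{- The family $\lambda:\mathrm{Dn}\,\mathrm{Up}\Rightarrow\mathrm{Up}\,\mathrm{Dn}$, with components $$\lambda_X:\mathrm{Dn}(\mathrm{Up}(X))\to\mathrm{Up}(\mathrm{Dn}(X)),\qquad \lambda_X(S)=\{T\in\mathrm{Dn}(X)\mid \forall s\in S,\ s\cap T\neq\emptyset\},$$ is a distributive law of the monad $\mathrm{Dn}$ over the monad $\mathrm{Up}$. That is, $\lambda$ is a natural transformation, and for every poset $X$ the following four identities hold: $\lambda_X\circ\eta^{\mathrm{Dn}}_{\mathrm{Up}X}=\mathrm{Up}(\eta^{\mathrm{Dn}}_X)$; $\lambda_X\circ\mathrm{Dn}(\eta^{\mathrm{Up}}_X)=\eta^{\mathrm{Up}}_{\mathrm{Dn}X}$; $\lambda_X\circ\mu^{\mathrm{Dn}}_{\mathrm{Up}X}=\mathrm{Up}(\mu^{\mathrm{Dn}}_X)\circ\lambda_{\mathrm{Dn}X}\circ\mathrm{Dn}(\lambda_X)$; $\lambda_X\circ\mathrm{Dn}(\mu^{\mathrm{Up}}_X)=\mu^{\mathrm{Up}}_{\mathrm{Dn}X}\circ\mathrm{Up}(\lambda_X)\circ\lambda_{\mathrm{Up}X}$.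
   Context: We work in $\mathbf{Poset}$, the category of partially ordered sets and monotone maps. For a poset $(X,\le)$ and $P\subseteq X$, we write $\uparrow P=\{x\mid\exists y\in P,\ y\le x\}$ and $\downarrow P=\{x\mid\exists y\in P,\ x\le y\}$; $f(P)$ denotes the direct image. Upset monad $(\mathrm{Up},\eta^{\mathrm{Up}},\mu^{\mathrm{Up}})$: - $\mathrm{Up}(X)$ is the set of upward closed subsets of $X$, ordered by reversed inclusion $\supseteq$. - $\mathrm{Up}(f)(P)=\uparrow f(P)$, with the closure taken in the codomain. - $\eta^{\mathrm{Up}}_X(x)=\uparrow\{x\}$. - $\mu^{\mathrm{Up}}_X(S)=\bigcup S$. Downset monad $(\mathrm{Dn},\eta^{\mathrm{Dn}},\mu^{\mathrm{Dn}})$: - $\mathrm{Dn}(X)$ is the set of downward closed subsets of $X$, ordered by inclusion $\subseteq$. - $\mathrm{Dn}(f)(P)=\downarrow f(P)$. - $\eta^{\mathrm{Dn}}_X(x)=\downarrow\{x\}$. - $\mu^{\mathrm{Dn}}_X(S)=\bigcup S$. Both are monads on $\mathbf{Poset}$. Note that elements of $\mathrm{Dn}(\mathrm{Up}(X))$ are sets of upsets of $X$ that are downward closed for the order $\supseteq$ on $\mathrm{Up}(X)$. -}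

module Defs where

open import Level using (Level; _⊔_; suc)
open import Data.Product using (Σ; ∃; _×_; _,_; proj₁; proj₂)
open import Relation.Unary using (Pred; _⊆_; _≐_)
open import Relation.Binary.Bundles using (Poset)

module _ {a ℓ₁ ℓ₂ : Level} (X : Poset a ℓ₁ ℓ₂) where
  open Poset X

  IsUpset : ∀ {p} → Pred Carrier p → Set (a ⊔ ℓ₂ ⊔ p)
  IsUpset P = ∀ {x y} → x ≤ y → P x → P y

  IsDownset : ∀ {p} → Pred Carrier p → Set (a ⊔ ℓ₂ ⊔ p)
  IsDownset P = ∀ {x y} → x ≤ y → P y → P x

  UpSet : (p : Level) → Set (a ⊔ ℓ₂ ⊔ suc p)
  UpSet p = Σ (Pred Carrier p) IsUpset

  DnSet : (p : Level) → Set (a ⊔ ℓ₂ ⊔ suc p)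
  DnSet p = Σ (Pred Carrier p) IsDownset

  -- Up(X) ordered by reversed inclusion, equality = extensional equality
  UpPoset : (p : Level) → Poset (a ⊔ ℓ₂ ⊔ suc p) (a ⊔ p) (a ⊔ p)
  UpPoset p = record
    { Carrier = UpSet p
    ; _≈_ = λ P Q → proj₁ P ≐ proj₁ Q
    ; _≤_ = λ P Q → proj₁ Q ⊆ proj₁ P
    ; isPartialOrder = record
      { isPreorder = record
        { isEquivalence = record
          { refl = (λ z → z) , (λ z → z)
          ; sym = λ e → proj₂ e , proj₁ e
          ; trans = λ e f → (λ z → proj₁ f (proj₁ e z)) , (λ z → proj₂ e (proj₂ f z))
          }
        ; reflexive = λ e → proj₂ e
        ; trans = λ i j z → i (j z)
        }
      ; antisym = λ i j → j , i
      }
    }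

  DnPoset : (p : Level) → Poset (a ⊔ ℓ₂ ⊔ suc p) (a ⊔ p) (a ⊔ p)
  DnPoset p = record
    { Carrier = DnSet p
    ; _≈_ = λ P Q → proj₁ P ≐ proj₁ Q
    ; _≤_ = λ P Q → proj₁ P ⊆ proj₁ Q
    ; isPartialOrder = record
      { isPreorder = record
        { isEquivalence = record
          { refl = (λ z → z) , (λ z → z)
          ; sym = λ e → proj₂ e , proj₁ e
          ; trans = λ e f → (λ z → proj₁ f (proj₁ e z)) , (λ z → proj₂ e (proj₂ f z))
          }
        ; reflexive = λ e → proj₁ e
        ; trans = λ i j z → j (i z)
        }
      ; antisym = λ i j → i , j
      }
    }

  ηUp : Carrier → UpSet ℓ₂
  ηUp x = (λ y → x ≤ y) , λ y≤z x≤y → trans x≤y y≤z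

  ηDn : Carrier → DnSet ℓ₂
  ηDn x = (λ y → y ≤ x) , λ y≤z z≤x → trans y≤z z≤x

μUp : ∀ {a ℓ₁ ℓ₂} (X : Poset a ℓ₁ ℓ₂) {p q : Level} →
      UpSet (UpPoset X p) q → UpSet X (a ⊔ ℓ₂ ⊔ suc p ⊔ q)
μUp X {p} S =
  (λ x → ∃ λ (s : UpSet X p) → proj₁ S s × proj₁ s x) ,
  λ x≤y h → proj₁ h , proj₁ (proj₂ h) , proj₂ (proj₁ h) x≤y (proj₂ (proj₂ h))

μDn : ∀ {a ℓ₁ ℓ₂} (X : Poset a ℓ₁ ℓ₂) {p q : Level} →
      DnSet (DnPoset X p) q → DnSet X (a ⊔ ℓ₂ ⊔ suc p ⊔ q)
μDn X {p} S =
  (λ x → ∃ λ (s : DnSet X p) → proj₁ S s × proj₁ s x) ,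
  λ x≤y h → proj₁ h , proj₁ (proj₂ h) , proj₂ (proj₁ h) x≤y (proj₂ (proj₂ h))

UpMap : ∀ {a ℓ₁ ℓ₂ b m₁ m₂} (X : Poset a ℓ₁ ℓ₂) (Y : Poset b m₁ m₂) {p : Level} →
        (Poset.Carrier X → Poset.Carrier Y) → UpSet X p → UpSet Y (a ⊔ p ⊔ m₂)
UpMap X Y f P =
  (λ y → ∃ λ x → proj₁ P x × Poset._≤_ Y (f x) y) ,
  λ y≤z h → proj₁ h , proj₁ (proj₂ h) , Poset.trans Y (proj₂ (proj₂ h)) y≤z

DnMap : ∀ {a ℓ₁ ℓ₂ b m₁ m₂} (X : Poset a ℓ₁ ℓ₂) (Y : Poset b m₁ m₂) {p : Level} →
        (Poset.Carrier X → Poset.Carrier Y) → DnSet X p → DnSet Y (a ⊔ p ⊔ m₂)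
DnMap X Y f P =
  (λ y → ∃ λ x → proj₁ P x × Poset._≤_ Y y (f x)) ,
  λ y≤z h → proj₁ h , proj₁ (proj₂ h) , Poset.trans Y y≤z (proj₂ (proj₂ h))

lam : ∀ {a ℓ₁ ℓ₂} (X : Poset a ℓ₁ ℓ₂) {p q : Level} →
      DnSet (UpPoset X p) q → (t : Level) → UpSet (DnPoset X t) (a ⊔ ℓ₂ ⊔ suc p ⊔ q ⊔ t)
lam X {p} S t =
  (λ T → (s : UpSet X p) → proj₁ S s → ∃ λ x → proj₁ s x × proj₁ T x) ,
  λ T⊆T' h s Ss → proj₁ (h s Ss) , proj₁ (proj₂ (h s Ss)) , T⊆T' (proj₂ (proj₂ (h s Ss)))

LamMonotone : ∀ {a ℓ₁ ℓ₂} (X : Poset a ℓ₁ ℓ₂) (p q t : Level) → Set _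
LamMonotone X p q t =
  (S S' : DnSet (UpPoset X p) q) →
  Poset._≤_ (DnPoset (UpPoset X p) q) S S' →
  Poset._≤_ (UpPoset (DnPoset X t) _) (lam X S t) (lam X S' t)

-- naturality: λ_Y ∘ Dn(Up f) = Up(Dn f) ∘ λ_X for every monotone f : X → Y
-- (downsets of X used by λ_X live at level t₀ = a ⊔ m₂ ⊔ k)
Naturality : ∀ {a ℓ₁ ℓ₂ b m₁ m₂} (X : Poset a ℓ₁ ℓ₂) (Y : Poset b m₁ m₂) (p q k : Level) → Set _
Naturality {a = a} {m₂ = m₂} X Y p q k =
  (f : Poset.Carrier X → Poset.Carrier Y) →
  (∀ {x y} → Poset._≤_ X x y → Poset._≤_ Y (f x) (f y)) →
  (S : DnSet (UpPoset X p) q) →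
  proj₁ (lam Y (DnMap (UpPoset X p) (UpPoset Y (a ⊔ p ⊔ m₂)) (UpMap X Y f) S) (a ⊔ m₂ ⊔ k))
  ≐ proj₁ (UpMap (DnPoset X (a ⊔ m₂ ⊔ k)) (DnPoset Y (a ⊔ m₂ ⊔ k)) (DnMap X Y f) (lam X S (a ⊔ m₂ ⊔ k)))

UnitDn : ∀ {a ℓ₁ ℓ₂} (X : Poset a ℓ₁ ℓ₂) (p : Level) → Set _
UnitDn {ℓ₂ = ℓ₂} X p =
  (P : UpSet X p) →
  proj₁ (lam X (ηDn (UpPoset X p) P) ℓ₂) ≐ proj₁ (UpMap X (DnPoset X ℓ₂) (ηDn X) P)

UnitUp : ∀ {a ℓ₁ ℓ₂} (X : Poset a ℓ₁ ℓ₂) (p : Level) → Set _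
UnitUp {ℓ₂ = ℓ₂} X p =
  (P : DnSet X p) →
  proj₁ (lam X (DnMap X (UpPoset X ℓ₂) (ηUp X) P) p) ≐ proj₁ (ηUp (DnPoset X p) P)

-- λ_X ∘ μ^Dn_{Up X} = Up(μ^Dn_X) ∘ λ_{Dn X} ∘ Dn(λ_X)
-- (intermediate levels: t₀ for Dn X inside, t₁ for Dn(Dn X))
MultDn : ∀ {a ℓ₁ ℓ₂} (X : Poset a ℓ₁ ℓ₂) (p q r : Level) → Set _
MultDn {a} {ℓ₁} {ℓ₂} X p q r =
  let t₀ = a ⊔ ℓ₂ ⊔ suc p ⊔ q
      t₁ = a ⊔ ℓ₂ ⊔ suc p ⊔ suc q ⊔ r in
  (S : DnSet (DnPoset (UpPoset X p) q) r) →
  proj₁ (lam X (μDn (UpPoset X p) S) (a ⊔ ℓ₂ ⊔ suc t₀ ⊔ t₁))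
  ≐ proj₁ (UpMap (DnPoset (DnPoset X t₀) t₁) (DnPoset X (a ⊔ ℓ₂ ⊔ suc t₀ ⊔ t₁)) (μDn X)
             (lam (DnPoset X t₀)
                  (DnMap (DnPoset (UpPoset X p) q) (UpPoset (DnPoset X t₀) (a ⊔ ℓ₂ ⊔ suc p ⊔ q ⊔ t₀))
                         (λ D → lam X D t₀) S)
                  t₁))

-- λ_X ∘ Dn(μ^Up_X) = μ^Up_{Dn X} ∘ Up(λ_X) ∘ λ_{Up X}
-- (downsets of Up X used by λ_{Up X} live at level t₀ = a ⊔ p ⊔ t)
MultUp : ∀ {a ℓ₁ ℓ₂} (X : Poset a ℓ₁ ℓ₂) (p q r t : Level) → Set _
MultUp {a} {ℓ₁} {ℓ₂} X p q r t =
  let t₀ = a ⊔ p ⊔ t in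
  (S : DnSet (UpPoset (UpPoset X p) q) r) →
  proj₁ (lam X (DnMap (UpPoset (UpPoset X p) q) (UpPoset X (a ⊔ ℓ₂ ⊔ suc p ⊔ q)) (μUp X) S) t)
  ≐ proj₁ (μUp (DnPoset X t)
             (UpMap (DnPoset (UpPoset X p) t₀) (UpPoset (DnPoset X t) (a ⊔ ℓ₂ ⊔ suc p ⊔ t₀ ⊔ t))
                    (λ R → lam X R t)
                    (lam (UpPoset X p) S t₀)))

module Submission where

-- Each of the four laws, and naturality, is an equality of upsets of downsets, and every
-- inclusion is witnessed by an explicit downset. The only non-trivial ones come from the
-- multiplication laws: if T meets every member of ⋃S, choosing a point of s ∩ T for each
-- s ∈ D ∈ S and taking down-closures splits T into a family of downsets Tᴰ ∈ λ(D); if T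
-- meets every ⋃𝒰 with 𝒰 ∈ S, then the upsets meeting T form a downset R ∈ λ(S) with T ∈ λ(R).
-- Naturality uses the preimage of a downset under a monotone map.

open import Defs
open import Level using (Level; _⊔_; suc)
open import Function using (id)
open import Data.Product using (_×_; _,_; proj₁; proj₂; ∃; Σ)
open import Relation.Unary using (Pred; _⊆_)
open import Relation.Binary.Bundles using (Poset)

downClosure : ∀ {a ℓ₁ ℓ₂ i} (Y : Poset a ℓ₁ ℓ₂) {I : Set i} →
              (I → Poset.Carrier Y) → DnSet Y (ℓ₂ ⊔ i)
downClosure Y g = (λ y → ∃ λ i → Poset._≤_ Y y (g i))
                , λ x≤y (i , y≤gi) → i , Poset.trans Y x≤y y≤gi

preimage : ∀ {a ℓ₁ ℓ₂ b m₁ m₂ l} (X : Poset a ℓ₁ ℓ₂) (Y : Poset b m₁ m₂)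
           (f : Poset.Carrier X → Poset.Carrier Y) →
           (∀ {x y} → Poset._≤_ X x y → Poset._≤_ Y (f x) (f y)) →
           DnSet Y l → DnSet X l
preimage X Y f mono T = (λ x → proj₁ T (f x)) , λ x≤y → proj₂ T (mono x≤y)

lam-natural : ∀ {a ℓ₁ ℓ₂ b m₁ m₂} (X : Poset a ℓ₁ ℓ₂) (Y : Poset b m₁ m₂) (p q k : Level) →
              Naturality X Y p q k
lam-natural X Y p q k f mono S =
    (λ {T} T∈ → preimage X Y f mono T , preimage∈λ T T∈ , λ (_ , fx∈T , y≤fx) → proj₂ T y≤fx fx∈T)
  , λ { (D , D∈λS , ↓fD⊆T) s' (s , s∈S , ↑fs⊆s') →
          let (x , x∈s , x∈D) = D∈λS s s∈S
          in f x , ↑fs⊆s' (x , x∈s , Poset.refl Y) , ↓fD⊆T (x , x∈D , Poset.refl Y) }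
  where
  preimage∈λ : ∀ {l} (T : DnSet Y l) →
               proj₁ (lam Y (DnMap (UpPoset X p) (UpPoset Y _) (UpMap X Y f) S) l) T →
               proj₁ (lam X S l) (preimage X Y f mono T)
  preimage∈λ T T∈ s s∈S =
    let (y , (x , x∈s , fx≤y) , y∈T) = T∈ (UpMap X Y f s) (s , s∈S , id)
    in x , x∈s , proj₂ T fx≤y y∈T

module _ {a ℓ₁ ℓ₂ : Level} (X : Poset a ℓ₁ ℓ₂) where
  open Poset X

  lam-monotone : ∀ p q t → LamMonotone X p q t
  lam-monotone p q t S S' S⊆S' T∈λS' s s∈S = T∈λS' s (S⊆S' s∈S)

  lam-ηDn : ∀ p → UnitDn X p
  lam-ηDn p P =
      (λ {T} T∈ → let (x , x∈P , x∈T) = T∈ P id in x , x∈P , λ y≤x → proj₂ T y≤x x∈T)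
    , λ (x , x∈P , ↓x⊆T) s P⊆s → x , P⊆s x∈P , ↓x⊆T refl

  lam-DnηUp : ∀ p → UnitUp X p
  lam-DnηUp p P =
      (λ {T} T∈ {x} x∈P → let (_ , x≤y , y∈T) = T∈ (ηUp X x) (x , x∈P , id) in proj₂ T x≤y y∈T)
    , λ P⊆T s (x , x∈P , s⊆↑x) → x , s⊆↑x refl , P⊆T x∈P

  module ChosenPoints {p q r L} (S : DnSet (DnPoset (UpPoset X p) q) r) (T : DnSet X L)
                      (T∈ : proj₁ (lam X (μDn (UpPoset X p) S) L) T) where

    t₀ : Level
    t₀ = a ⊔ ℓ₂ ⊔ suc p ⊔ q

    t₁ : Level
    t₁ = a ⊔ ℓ₂ ⊔ suc p ⊔ suc q ⊔ r

    meet : ∀ D → proj₁ S D → (s : UpSet X p) → proj₁ D s → ∃ λ x → proj₁ s x × proj₁ T x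
    meet D D∈S s s∈D = T∈ s (D , D∈S , s∈D)

    Tᴰ : ∀ D → proj₁ S D → DnSet X t₀
    Tᴰ D D∈S = downClosure X {I = Σ (UpSet X p) (proj₁ D)} λ (s , s∈D) → proj₁ (meet D D∈S s s∈D)

    Tᴰ∈λ : ∀ D (D∈S : proj₁ S D) → proj₁ (lam X D t₀) (Tᴰ D D∈S)
    Tᴰ∈λ D D∈S s s∈D = let (x , x∈s , _) = meet D D∈S s s∈D in x , x∈s , (s , s∈D) , refl

    𝒯 : DnSet (DnPoset X t₀) t₁
    𝒯 = downClosure (DnPoset X t₀) {I = Σ (DnSet (UpPoset X p) q) (proj₁ S)} λ (D , D∈S) → Tᴰ D D∈S

    𝒯∈λ : proj₁ (lam (DnPoset X t₀) (DnMap (DnPoset (UpPoset X p) q) (UpPoset (DnPoset X t₀) _)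
                                             (λ D → lam X D t₀) S) t₁) 𝒯
    𝒯∈λ u (D , D∈S , λD⊆u) = Tᴰ D D∈S , λD⊆u (Tᴰ∈λ D D∈S) , (D , D∈S) , id

    ⋃𝒯⊆T : proj₁ (μDn X 𝒯) ⊆ proj₁ T
    ⋃𝒯⊆T (_ , ((D , D∈S) , T'⊆Tᴰ) , x∈T') =
      let ((s , s∈D) , x≤y) = T'⊆Tᴰ x∈T' in proj₂ T x≤y (proj₂ (proj₂ (meet D D∈S s s∈D)))

  lam-μDn : ∀ p q r → MultDn X p q r
  lam-μDn p q r S =
      (λ {T} T∈ → let open ChosenPoints S T T∈ in 𝒯 , 𝒯∈λ , ⋃𝒯⊆T)
    , λ (𝒯 , 𝒯∈λ , ⋃𝒯⊆T) s (D , D∈S , s∈D) →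
        let (T' , T'∈λD , T'∈𝒯) = 𝒯∈λ (lam X D _) (D , D∈S , id)
            (x , x∈s , x∈T') = T'∈λD s s∈D
        in x , x∈s , ⋃𝒯⊆T (T' , T'∈𝒯 , x∈T')

  meeting : ∀ {p l} → Pred Carrier l → DnSet (UpPoset X p) (a ⊔ p ⊔ l)
  meeting T = (λ u → ∃ λ x → proj₁ u x × T x)
            , λ u⊆u' (x , x∈u' , x∈T) → x , u⊆u' x∈u' , x∈T

  lam-DnμUp : ∀ p q r t → MultUp X p q r t
  lam-DnμUp p q r t S =
      (λ {T} T∈ → lam X (meeting (proj₁ T)) t
                , (meeting (proj₁ T) , meeting∈λ T T∈ , id)
                , λ _ u∩T → u∩T)
    , λ (V , (R , R∈λS , V⊆λR) , T∈V) s (𝒰 , 𝒰∈S , ⋃𝒰⊆s) →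
        let (u , u∈𝒰 , u∈R) = R∈λS 𝒰 𝒰∈S
            (x , x∈u , x∈T) = V⊆λR T∈V u u∈R
        in x , ⋃𝒰⊆s (u , u∈𝒰 , x∈u) , x∈T
    where
    meeting∈λ : (T : DnSet X t) →
                proj₁ (lam X (DnMap (UpPoset (UpPoset X p) q) (UpPoset X _) (μUp X) S) t) T →
                proj₁ (lam (UpPoset X p) S (a ⊔ p ⊔ t)) (meeting (proj₁ T))
    meeting∈λ T T∈ 𝒰 𝒰∈S =
      let (x , (u , u∈𝒰 , x∈u) , x∈T) = T∈ (μUp X 𝒰) (𝒰 , 𝒰∈S , id)
      in u , u∈𝒰 , x , x∈u , x∈T

mainTheorem4 : ∀ {a ℓ₁ ℓ₂ b m₁ m₂} (X : Poset a ℓ₁ ℓ₂) (Y : Poset b m₁ m₂) (p q r t k : Level) →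
    LamMonotone X p q t × Naturality X Y p q k × UnitDn X p × UnitUp X p × MultDn X p q r × MultUp X p q r t
mainTheorem4 X Y p q r t k =
  lam-monotone X p q t , lam-natural X Y p q k , lam-ηDn X p , lam-DnηUp X p , lam-μDn X p q r , lam-DnμUp X p q r t
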